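{- For every prime $p$, every $S\subseteq\mathbb{Z}_p$ and every $\alpha\in(0,1]$, $$\tfrac12\mathcal{C}_\alpha(S)\le\mathcal{C}^{\mathrm{BSGS}}_\alpha(S)\le\mathcal{C}^{\mathrm{BSGS1}}_\alpha(S).$$
   Context: $\mathbb{Z}_p$ is the field of residues modulo $p$. For $L\subseteq\mathbb{Z}_p^2$, $I(L)=\{x:\exists (a,b)\neq(a',b')\in L,\ ax+b=a'x+b'\}$, and $\mathcal{C}_\alpha(S)$ is the smallest $|L|$ with $|S\cap I(L)|\ge\alpha|S|$. For $L\subseteq\mathbb{Z}_p^2$, $C\subseteq\mathbb{Z}_p$, $I(L,C)=\{x\in\mathbb{Z}_p:\exists (a,b)\in L,\ c\in C,\ a\neq0,\ ax+b=c\}$. $\mathcal{C}^{\mathrm{BSGS}}_\alpha(S)$ is the smallest integer $m$ such that there exist $L\subseteq\mathbb{Z}_p^2$, $C\subseteq\mathbb{Z}_p$ with $|L|=|C|=m$ and $|I(L,C)\cap S|\ge\alpha|S|$; $\mathcal{C}^{\mathrm{BSGS1}}_\alpha(S)$ is defined the same way but with $L\subseteq\{1\}\times\mathbb{Z}_p$.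
   Formalization: The parameter α ranges over the rationals in $(0,1]$. -}

module Defs where

open import Data.Nat using (ℕ; _+_; _*_; _%_; _≤_; NonZero)
open import Data.Fin using (Fin; toℕ)
open import Data.Fin.Subset using (Subset; _∈_; _⊆_; ∣_∣)
open import Data.Product using (_×_; _,_; Σ; ∃; ∃-syntax; proj₁)
open import Data.List using (List; length)
open import Data.List.Relation.Unary.Unique.Propositional using (Unique)
import Data.List.Membership.Propositional as LM
open import Data.Integer using (+_)
open import Data.Rational using (ℚ; _/_) renaming (_*_ to _*ℚ_; _≤_ to _≤ℚ_)
open import Relation.Binary.PropositionalEquality using (_≡_; _≢_)
open import Relation.Nullary using (¬_)

-- Elements of ℤ_p are represented by Fin p; arithmetic is taken modulo p.

affine : (p : ℕ) .{{_ : NonZero p}} → Fin p × Fin p → Fin p → ℕ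
affine p (a , b) x = (toℕ a * toℕ x + toℕ b) % p

-- A finite set of "lines" L ⊆ ℤ_p², represented as a duplicate-free list;
-- |L| = length of the list.
Lines : ℕ → Set
Lines p = Σ (List (Fin p × Fin p)) Unique

Points : ℕ → Set
Points p = Σ (List (Fin p)) Unique

size : {A : Set} → Σ (List A) Unique → ℕ
size (xs , _) = length xs

I : (p : ℕ) .{{_ : NonZero p}} → Lines p → Fin p → Set
I p (L , _) x = ∃[ l ] ∃[ l' ] (l LM.∈ L × l' LM.∈ L × l ≢ l' × affine p l x ≡ affine p l' x)

I₂ : (p : ℕ) .{{_ : NonZero p}} → Lines p → Points p → Fin p → Set
I₂ p (L , _) (C , _) x =
  ∃[ a ] ∃[ b ] ∃[ c ] ((a , b) LM.∈ L × toℕ a ≢ 0 × c LM.∈ C × affine p (a , b) x ≡ toℕ c)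

ℕ→ℚ : ℕ → ℚ
ℕ→ℚ n = (+ n) / 1

-- |S ∩ P| ≥ α |S|, expressed as: some T ⊆ S with all elements in P has |T| ≥ α|S|
-- (equivalently, the number of elements of S satisfying P is at least α|S|).
Covers : {p : ℕ} → Subset p → (Fin p → Set) → ℚ → Set
Covers {p} S P α = ∃[ T ] (T ⊆ S × (∀ {x} → x ∈ T → P x) × α *ℚ ℕ→ℚ ∣ S ∣ ≤ℚ ℕ→ℚ ∣ T ∣)

IsLeast : (ℕ → Set) → ℕ → Set
IsLeast Q m = Q m × (∀ k → Q k → m ≤ k)

AchC : (p : ℕ) .{{_ : NonZero p}} → Subset p → ℚ → ℕ → Set
AchC p S α m = ∃[ L ] (size L ≡ m × Covers S (I p L) α)

AchBSGS : (p : ℕ) .{{_ : NonZero p}} → Subset p → ℚ → ℕ → Set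
AchBSGS p S α m =
  ∃[ L ] ∃[ C ] (size L ≡ m × size C ≡ m × Covers S (I₂ p L C) α)

AchBSGS1 : (p : ℕ) .{{_ : NonZero p}} → Subset p → ℚ → ℕ → Set
AchBSGS1 p S α m =
  ∃[ L ] ∃[ C ] (size L ≡ m × size C ≡ m
    × (∀ {a b} → (a , b) LM.∈ proj₁ L → toℕ a ≡ 1)
    × Covers S (I₂ p L C) α)

{-# OPTIONS --safe #-}
module Submission where

-- Dropping the lines of zero slope from L and adding the constant line y = c for every c ∈ C
-- turns a baby-step giant-step witness (L, C) into a set of at most |L| + |C| lines: when
-- a x + b = c with a ≠ 0, the line (a, b) and the constant line (0, c) are distinct and meet
-- at x. A witness with L ⊆ {1} × ℤ_p is in particular a baby-step giant-step witness.

open import Defs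
open import Data.Nat using (ℕ; NonZero; _≤_; _*_)
open import Data.Nat.Primality using (Prime)
open import Data.Fin.Subset using (Subset)
open import Data.Rational using (ℚ; 0ℚ; 1ℚ; _<_)
open import Data.Product using (_×_)
import Data.Rational as Q

open import Data.Nat using (suc; _+_; _≟_)
open import Data.Nat.Properties using (+-mono-≤; +-identityʳ; ≤-reflexive; ≤-trans; module ≤-Reasoning)
open import Data.Nat.DivMod using (m<n⇒m%n≡m)
open import Data.Fin using (Fin; toℕ; zero)
open import Data.Fin.Properties using (toℕ<n)
open import Data.Product using (_,_; proj₁; proj₂; ∃-syntax)
open import Data.List using (List; filter; map; _++_; length)
open import Data.List.Properties using (length-++; length-map; length-filter)
open import Data.List.Membership.Propositional using (_∈_)
open import Data.List.Membership.Propositional.Properties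
  using (∈-filter⁺; ∈-filter⁻; ∈-++⁺ˡ; ∈-++⁺ʳ; ∈-map⁺; ∈-map⁻)
open import Data.List.Relation.Unary.Unique.Propositional using (Unique)
import Data.List.Relation.Unary.Unique.Propositional.Properties as Unique
open import Relation.Nullary using (¬_; ¬?; Dec)
open import Relation.Unary using (Pred; _⊆_)
open import Relation.Binary.PropositionalEquality using (_≡_; refl; sym; trans; cong)

Covers-mono : ∀ {p} {S : Subset p} {P Q : Pred (Fin p) _} {α : ℚ} →
  P ⊆ Q → Covers S P α → Covers S Q α
Covers-mono P⊆Q (T , T⊆S , T⊆P , bound) = T , T⊆S , (λ x∈T → P⊆Q (T⊆P x∈T)) , bound

constLine : ∀ {n} → Fin n → Fin n × Fin n
constLine {suc _} c = zero , c

constLine-slope : ∀ {n} (c : Fin n) → toℕ (proj₁ (constLine c)) ≡ 0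
constLine-slope {suc _} c = refl

constLine-injective : ∀ {n} {c d : Fin n} → constLine c ≡ constLine d → c ≡ d
constLine-injective {suc _} refl = refl

affine-constLine : ∀ p .{{_ : NonZero p}} (c x : Fin p) → affine p (constLine c) x ≡ toℕ c
affine-constLine (suc _) c x = m<n⇒m%n≡m (toℕ<n c)

nonzeroSlope? : ∀ {n} (l : Fin n × Fin n) → Dec (¬ toℕ (proj₁ l) ≡ 0)
nonzeroSlope? l = ¬? (toℕ (proj₁ l) ≟ 0)

module _ {p : ℕ} .{{_ : NonZero p}} (L : Lines p) (C : Points p) where

  private
    sloped constant : List (Fin p × Fin p)
    sloped   = filter nonzeroSlope? (proj₁ L)
    constant = map constLine (proj₁ C)

    sloped-disjoint-constant : ∀ {l} → ¬ (l ∈ sloped × l ∈ constant)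
    sloped-disjoint-constant (l∈sloped , l∈constant) with ∈-map⁻ constLine l∈constant
    ... | c , _ , refl = proj₂ (∈-filter⁻ nonzeroSlope? {xs = proj₁ L} l∈sloped) (constLine-slope c)

  collisionLines : Lines p
  collisionLines = sloped ++ constant
                 , Unique.++⁺ (Unique.filter⁺ nonzeroSlope? {proj₁ L} (proj₂ L))
                              (Unique.map⁺ constLine-injective (proj₂ C))
                              sloped-disjoint-constant

  size-collisionLines : size collisionLines ≤ size L + size C
  size-collisionLines = begin
    length (sloped ++ constant)        ≡⟨ length-++ sloped ⟩
    length sloped + length constant    ≤⟨ +-mono-≤ (length-filter nonzeroSlope? (proj₁ L))
                                                   (≤-reflexive (length-map constLine (proj₁ C))) ⟩
    size L + size C                    ∎
    where open ≤-Reasoning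

  I₂⊆I-collisionLines : I₂ p L C ⊆ I p collisionLines
  I₂⊆I-collisionLines {x} (a , b , c , ab∈L , a≢0 , c∈C , ax+b≡c) =
    (a , b) , constLine c ,
    ∈-++⁺ˡ (∈-filter⁺ nonzeroSlope? ab∈L a≢0) , ∈-++⁺ʳ sloped (∈-map⁺ constLine c∈C) ,
    (λ ab≡const → a≢0 (trans (cong (λ l → toℕ (proj₁ l)) ab≡const) (constLine-slope c))) ,
    trans ax+b≡c (sym (affine-constLine p c x))

AchBSGS⇒AchC : ∀ p .{{_ : NonZero p}} (S : Subset p) (α : ℚ) (m : ℕ) →
  AchBSGS p S α m → ∃[ k ] (AchC p S α k × k ≤ 2 * m)
AchBSGS⇒AchC p S α m (L , C , refl , |C|≡m , covers) =
  size (collisionLines L C) ,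
  (collisionLines L C , refl , Covers-mono {α = α} (I₂⊆I-collisionLines L C) covers) ,
  ≤-trans (size-collisionLines L C) (≤-reflexive (cong (m +_) (trans |C|≡m (sym (+-identityʳ m)))))

AchBSGS1⇒AchBSGS : ∀ p .{{_ : NonZero p}} (S : Subset p) (α : ℚ) (m : ℕ) →
  AchBSGS1 p S α m → AchBSGS p S α m
AchBSGS1⇒AchBSGS p S α m (L , C , |L|≡m , |C|≡m , _ , covers) = L , C , |L|≡m , |C|≡m , covers

proposition3 : (p : ℕ) .{{_ : NonZero p}} → Prime p → (S : Subset p) → (α : ℚ)
    → 0ℚ < α → α Q.≤ 1ℚ → (m₁ m₂ m₃ : ℕ)
    → IsLeast (AchC p S α) m₁ → IsLeast (AchBSGS p S α) m₂ → IsLeast (AchBSGS1 p S α) m₃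
    → (m₁ ≤ 2 * m₂) × (m₂ ≤ m₃)
proposition3 p _ S α _ _ m₁ m₂ m₃ (_ , m₁-least) (achieves₂ , m₂-least) (achieves₃ , _) =
  let (k , achievesC , k≤2m₂) = AchBSGS⇒AchC p S α m₂ achieves₂
  in ≤-trans (m₁-least k achievesC) k≤2m₂ ,
     m₂-least m₃ (AchBSGS1⇒AchBSGS p S α m₃ achieves₃)
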